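{- Let $a\in\mathbb{N}$, $a\ge3$, $S=\langle a,a+1,a+2\rangle$, $L=\lfloor(a-1)/2\rfloor$, $D=\lfloor(a+3)/4\rfloor$. Let $d\in\mathbb{N}$ with $1\le d\le D$ and set $I_d=L+2-2d$. Then: (1) $2D\le L+2$ and $0\le I_d\le L$; (2) for $i\in\llbracket 0,I_d\rrbracket$: $2d-2+i\in\llbracket 0,L\rrbracket$, $S_{d,i}\subseteq\llbracket 0,\mathscr{L}_a)\!)$, and $S_{d,i}=S_d\cap S^{2d-2+i}$; (3) $S_d\cap\left(\bigcup_{\ell=0}^LS^\ell\right)=\bigcup_{i=0}^{I_d}S_{d,i}$; (4) $S\cap\llbracket 0,(a+2)L\rrbracket=\left(\bigcup_{d=1}^DS_d\right)\cap\left(\bigcup_{\ell=0}^LS^\ell\right)$. Let $r_d=(a+1)(2d-2)$. Then: (5) $S_{d,0}=\{r_d\}$, $r_d=\min\left(S_d\cap\bigcup_{\ell=0}^LS^\ell\right)$, and $W_{r_d}$ is spanned by the monomials $x^{d-1-j}y^{2j}z^{d-1-j}$, $0\le j\le d-1$ (i.e. $W_{r_d}=\langle x^{d-1}z^{d-1},\dots,y^{2d-2}\rangle$); (6) if $r\in S_{d,1}$: if $c_r=-1$ then $W_r=xW_{r_d}$; if $c_r=0$ then $W_r=yW_{r_d}$; if $c_r=1$ then $W_r=zW_{r_d}$; (7) if $r\in S_{d,i}$ for some $2\le i\le I_d$: if $c_r=-i$ then $W_r=x^iW_{r_d}$; if $c_r=-i+1$ then $W_r=x^{i-1}yW_{r_d}$;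 if $c_r=i-1$ then $W_r=yz^{i-1}W_{r_d}$; if $c_r=i$ then $W_r=z^iW_{r_d}$.
   Context: $\mathbb{N}=\{0,1,2,\dots\}$. $S=\langle a,a+1,a+2\rangle=\{\alpha_1a+\alpha_2(a+1)+\alpha_3(a+2):\alpha_i\in\mathbb{N}\}$. $\operatorname{F}(r,S)=\{\alpha\in\mathbb{N}^3:\alpha_1a+\alpha_2(a+1)+\alpha_3(a+2)=r\}$, $|\alpha|=\alpha_1+\alpha_2+\alpha_3$, $\operatorname{L}(r,S)=\{|\alpha|:\alpha\in\operatorname{F}(r,S)\}$. $S^\ell=\{r\in S:\operatorname{L}(r,S)=\{\ell\}\}$ and $S_d=\{r\in S:\operatorname{card}\operatorname{F}(r,S)=d\}$. For $i\in\mathbb{N}$: $\Gamma_0=\{0\}$, $\Gamma_1=\{ -1,0,1\}$, $\Gamma_i=\{ -i,-i+1,i-1,i\}$ for $i\ge2$; and $S_{d,i}=\{(a+1)(2d-2+i)+c:c\in\Gamma_i\}$. $\mathscr{L}_a=\lfloor a/2\rfloor (a+2)$ if $a$ is even, and $\mathscr{L}_a=(\lfloor a/2\rfloor+2)a$ if $a$ is odd. $\llbracket x,y\rrbracket=\{n\in\mathbb{Z}:x\le n\le y\}$, $\llbracket x,y)\!)=\{n\in\mathbb{Z}:x\le n<y\}$. For $r\in\mathbb{N}$: $\ell_r=\lfloor r/a\rfloor$, $\varepsilon_r=r-a\ell_r$, $\phi_r=(\phi_{r,1},\phi_{r,2},\phi_{r,3})=(\ell_r-\lfloor(\varepsilon_r+1)/2\rfloor,\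 \varepsilon_r-2\lfloor\varepsilon_r/2\rfloor,\ \lfloor\varepsilon_r/2\rfloor)$, and $c_r=\phi_{r,3}-\phi_{r,1}$. Let $\mathbb{K}$ be a field and $x,y,z$ variables; for $r\in S$, $W_r$ is the $\mathbb{K}$-vector subspace of $\mathbb{K}[x,y,z]$ spanned by the monomials $x^{\alpha_1}y^{\alpha_2}z^{\alpha_3}$ with $\alpha\in\operatorname{F}(r,S)$; for a monomial $m$, $mW=\{mf:f\in W\}$. -}

module Defs where

open import Level using (Level; _⊔_) renaming (suc to lsuc)
open import Data.Nat using (ℕ; zero; suc; _+_; _*_; _∸_; _≤_; _<_; _/_; _%_)
open import Data.Nat.Properties using (_≟_)
open import Data.Integer using (ℤ; +_; -_) renaming (_+_ to _+ℤ_; _-_ to _-ℤ_)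
open import Data.Product using (Σ; _×_; _,_; proj₁; proj₂)
open import Data.Sum using (_⊎_)
open import Data.List using (List; foldr)
open import Data.List.Relation.Unary.All using (All)
open import Data.Bool using (if_then_else_)
open import Relation.Nullary using (¬_; does)
open import Relation.Binary.PropositionalEquality using (_≡_)
open import Function.Bundles using (_↔_)
open import Algebra.Bundles using (CommutativeRing)
open import Data.Fin using (Fin)
import Data.Product.Properties
import Relation.Nullary

record Field (c ℓ : Level) : Set (lsuc (c ⊔ ℓ)) where
  field
    commutativeRing : CommutativeRing c ℓ
  open CommutativeRing commutativeRing public
    using (Carrier; _≈_; 0#; 1#) renaming (_+_ to _⊕_; _*_ to _⊗_)
  field
    0≉1     : ¬ (0# ≈ 1#)
    inverse : ∀ x → ¬ (x ≈ 0#) → Σ Carrier (λ y → (x ⊗ y) ≈ 1#)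

Mon : Set
Mon = ℕ × ℕ × ℕ

ev : ℕ → Mon → ℕ
ev a (α₁ , α₂ , α₃) = α₁ * a + α₂ * (a + 1) + α₃ * (a + 2)

len : Mon → ℕ
len (α₁ , α₂ , α₃) = α₁ + α₂ + α₃

InF : ℕ → ℕ → Mon → Set
InF a r α = ev a α ≡ r

Fact : ℕ → ℕ → Set
Fact a r = Σ Mon (InF a r)

InS : ℕ → ℕ → Set
InS a r = Fact a r

InSℓ : ℕ → ℕ → ℕ → Set
InSℓ a ℓ r = InS a r × (∀ α → InF a r α → len α ≡ ℓ)

InSd : ℕ → ℕ → ℕ → Set
InSd a d r = InS a r × (Fin d ↔ Fact a r)

Γ : ℕ → ℤ → Set
Γ zero c = c ≡ + 0
Γ (suc zero) c = (c ≡ - (+ 1)) ⊎ (c ≡ + 0) ⊎ (c ≡ + 1)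
Γ (suc (suc k)) c =
  (c ≡ - (+ i)) ⊎ (c ≡ - (+ i) +ℤ + 1) ⊎ (c ≡ + i -ℤ + 1) ⊎ (c ≡ + i)
  where i = suc (suc k)

-- r ∈ S_{d,i} ⊆ ℤ : r = (a+1)(2d-2+i) + c with c ∈ Γ_i   (d ≥ 1 assumed
-- wherever used, so 2 * d ∸ 2 + i = 2d-2+i)
InSdi : ℕ → ℕ → ℕ → ℤ → Set
InSdi a d i r = Σ ℤ (λ c → Γ i c × (r ≡ + ((a + 1) * ((2 * d ∸ 2) + i)) +ℤ c))

𝓛 : ℕ → ℕ
𝓛 a = if does ((a % 2) ≟ 0) then (a / 2) * (a + 2) else (a / 2 + 2) * a

module _ (a : ℕ) .{{_ : Data.Nat.NonZero a}} where
  ℓr : ℕ → ℕ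
  ℓr r = r / a

  εr : ℕ → ℕ
  εr r = r % a

  φr : ℕ → Mon
  φr r = (ℓr r ∸ ((εr r + 1) / 2)) , (εr r ∸ 2 * (εr r / 2)) , (εr r / 2)

  cr : ℕ → ℤ
  cr r = + proj₂ (proj₂ (φr r)) -ℤ + proj₁ (φr r)

module Poly {c ℓ : Level} (K : Field c ℓ) where
  open Field K

  Pol : Set c
  Pol = Mon → Carrier

  _≟M_ : (α β : Mon) → Relation.Nullary.Dec (α ≡ β)
  _≟M_ = Data.Product.Properties.≡-dec _≟_ (Data.Product.Properties.≡-dec _≟_ _≟_)

  terms : List (Carrier × Mon) → Pol
  terms ts β = foldr (λ t acc → (if does (proj₂ t ≟M β) then proj₁ t else 0#) ⊕ acc) 0# ts

  InSpan : (Mon → Set) → Pol → Set (c ⊔ ℓ)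
  InSpan P f = Σ (List (Carrier × Mon))
                 (λ ts → All (λ t → P (proj₂ t)) ts × (∀ β → f β ≈ terms ts β))

  InW : ℕ → ℕ → Pol → Set (c ⊔ ℓ)
  InW a r = InSpan (InF a r)

  mulMon : Mon → Pol → Pol
  mulMon (m₁ , m₂ , m₃) f (β₁ , β₂ , β₃) =
    if does (m₁ Data.Nat.≤? β₁) then
      (if does (m₂ Data.Nat.≤? β₂) then
        (if does (m₃ Data.Nat.≤? β₃) then f (β₁ ∸ m₁ , β₂ ∸ m₂ , β₃ ∸ m₃) else 0#)
       else 0#)
     else 0#

  InMulW : Mon → (Pol → Set (c ⊔ ℓ)) → Pol → Set (c ⊔ ℓ)
  InMulW m W g = Σ Pol (λ f → W f × (∀ β → g β ≈ mulMon m f β))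

  SameSet : (Pol → Set (c ⊔ ℓ)) → (Pol → Set (c ⊔ ℓ)) → Set (c ⊔ ℓ)
  SameSet V W = ∀ f → (V f → W f) × (W f → V f)

infix 3 _⟺_
_⟺_ : ∀ {p q} → Set p → Set q → Set (p ⊔ q)
A ⟺ B = (A → B) × (B → A)

Lof : ℕ → ℕ
Lof a = (a ∸ 1) / 2

Dof : ℕ → ℕ
Dof a = (a + 3) / 4

-- I_d = L + 2 - 2d  (truncated subtraction; the statement asserts 2d ≤ L+2)
Iof : ℕ → ℕ → ℕ
Iof a d = (Lof a + 2) ∸ 2 * d

rof : ℕ → ℕ → ℕ
rof a d = (a + 1) * (2 * d ∸ 2)

InUnionSℓ : ℕ → ℕ → Set
InUnionSℓ a r = Σ ℕ (λ l → l ≤ Lof a × InSℓ a l r)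

RdMon : ℕ → Mon → Set
RdMon d α = Σ ℕ (λ j → j ≤ d ∸ 1 × α ≡ ((d ∸ 1) ∸ j , 2 * j , (d ∸ 1) ∸ j))

-- Every monomial factors uniquely as x^m (xz)^t y^(2j) with m reduced, i.e. of
-- the form x^k y^p or y^p z^k with p ≤ 1; as xz and y² both have degree 2(a + 1),
-- its degree is atLevel a m (t + j) = ev m + 2(a + 1)(t + j).  A monomial with n
-- factors has degree between n a and n (a + 2), so for lengths ℓ with 2ℓ < a the
-- degree r = ℓ a + e determines ℓ = len m + 2k and the remainder e = wt m + 2k,
-- and these determine m and the level k.  Hence the factorizations of r are
-- exactly x^m (xz)^t y^(2(k - t)) for t ≤ k: there are k + 1 of them, all of
-- length ℓ, and dividing by x^m identifies W_r with x^m W_{r_(k+1)}.  Writing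
-- r = (a + 1)(2k + len m) + (m₃ - m₁) identifies S_{k+1,i} with the degrees at
-- level k of the reduced m of length i, the offset m₃ - m₁ running through Γ_i.

module Submission where

open import Defs
open import Level using (Level)
open import Data.Nat using (ℕ; _+_; _*_; _∸_; _≤_; NonZero)
open import Data.Integer using (ℤ; +_; -_) renaming (_≤_ to _≤ℤ_; _<_ to _<ℤ_; _+_ to _+ℤ_)
open import Data.Product using (Σ; _×_; _,_)
open import Relation.Binary.PropositionalEquality using (_≡_)

open import Data.Nat using (zero; suc; _<_; z≤n; s≤s; _/_; _%_; _≤?_; >-nonZero)
open import Data.Nat.Properties
open import Data.Nat.DivMod
open import Data.Nat.Divisibility using (divides-refl)
open import Data.Nat.Tactic.RingSolver using (solve-∀)
open import Data.Integer using (+≤+; +<+) renaming (_-_ to _-ℤ_)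
import Data.Integer.Properties as ZP
open import Data.Integer.Tactic.RingSolver using () renaming (solve-∀ to ℤ-solve-∀)
open import Data.Product using (proj₁; proj₂; map₂)
open import Algebra.Bundles using (CommutativeRing)
open import Data.Sum using (_⊎_; inj₁; inj₂)
open import Data.Empty using (⊥-elim)
open import Data.Fin using (Fin; zero; toℕ; fromℕ<)
open import Data.Fin.Properties using (toℕ-fromℕ<; toℕ-injective; toℕ<n; cantor-schröder-bernstein)
open import Function.Bundles using (_↔_; mk↔ₛ′; Injection; Inverse)
open import Function using (_∘_)
open import Function.Properties.Inverse using (↔-sym; ↔-trans; ↔⇒↣)
open import Relation.Nullary using (yes; no)
open import Relation.Nullary.Decidable using (dec-true; dec-false; does-≡; map′)
open import Data.Bool using (if_then_else_)
open import Data.List using (List; []; _∷_; map)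
open import Data.List.Relation.Unary.All using (All; []; _∷_)
import Data.List.Relation.Unary.All as All
import Data.List.Relation.Unary.All.Properties as All
open import Relation.Binary.PropositionalEquality
  using (_≢_; refl; sym; trans; cong; cong₂; subst; subst₂; module ≡-Reasoning)

2[1+k]≡2+2k : ∀ k → 2 * suc k ≡ 2 + 2 * k
2[1+k]≡2+2k k = *-distribˡ-+ 2 1 k

2[1+k]∸2≡2k : ∀ k → 2 * suc k ∸ 2 ≡ 2 * k
2[1+k]∸2≡2k k = cong (_∸ 2) (2[1+k]≡2+2k k)

n≡n%2+2*[n/2] : ∀ n → n ≡ n % 2 + 2 * (n / 2)
n≡n%2+2*[n/2] n = trans (m≡m%n+[m/n]*n n 2) (cong (λ q → n % 2 + q) (*-comm (n / 2) 2))

n%2≤1 : ∀ n → n % 2 ≤ 1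
n%2≤1 n = ≤-pred (m%n<n n 2)

[qn+r]/n≡q : ∀ {n} .{{_ : NonZero n}} q {r} → r < n → (q * n + r) / n ≡ q
[qn+r]/n≡q {n} q {r} r<n = begin
  (q * n + r) / n     ≡⟨ +-distrib-/-∣ˡ r (divides-refl q) ⟩
  q * n / n + r / n   ≡⟨ cong₂ _+_ (m*n/n≡m q n) (m<n⇒m/n≡0 r<n) ⟩
  q + 0               ≡⟨ +-identityʳ q ⟩
  q                   ∎
  where open ≡-Reasoning

[qn+r]%n≡r : ∀ {n} .{{_ : NonZero n}} q {r} → r < n → (q * n + r) % n ≡ r
[qn+r]%n≡r {n} q {r} r<n =
  trans (cong (_% n) (+-comm (q * n) r)) (trans ([m+kn]%n≡m%n r q n) (m<n⇒m%n≡m r<n))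

[2h+1]/2≡h : ∀ h → (2 * h + 1) / 2 ≡ h
[2h+1]/2≡h h = trans (cong (λ l → (l + 1) / 2) (*-comm 2 h)) ([qn+r]/n≡q h (s≤s (s≤s z≤n)))

[p+2h]/2≡h : ∀ {p} h → p ≤ 1 → (p + 2 * h) / 2 ≡ h
[p+2h]/2≡h h z≤n = trans (cong (_/ 2) (*-comm 2 h)) (m*n/n≡m h 2)
[p+2h]/2≡h h (s≤s z≤n) = trans (cong (_/ 2) (+-comm 1 (2 * h))) ([2h+1]/2≡h h)

[p+2h+1]/2≡p+h : ∀ {p} h → p ≤ 1 → (p + 2 * h + 1) / 2 ≡ p + h
[p+2h+1]/2≡p+h h z≤n = [2h+1]/2≡h h
[p+2h+1]/2≡p+h h (s≤s z≤n) = trans (cong (_/ 2) (identity h)) (m*n/n≡m (1 + h) 2)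
  where
  identity : ∀ h → 1 + 2 * h + 1 ≡ (1 + h) * 2
  identity = solve-∀

m+n≡o+p⇒+m≡+o+[+p-+n] : ∀ {m n o p} → m + n ≡ o + p → + m ≡ + o +ℤ (+ p -ℤ + n)
m+n≡o+p⇒+m≡+o+[+p-+n] {m} {n} {o} {p} eq = begin
  + m                      ≡⟨ cancel (+ m) (+ n) ⟩
  (+ m +ℤ + n) -ℤ + n      ≡⟨ cong (_-ℤ + n) (ZP.pos-+ m n) ⟨
  + (m + n) -ℤ + n         ≡⟨ cong (λ l → + l -ℤ + n) eq ⟩
  + (o + p) -ℤ + n         ≡⟨ cong (_-ℤ + n) (ZP.pos-+ o p) ⟩
  (+ o +ℤ + p) -ℤ + n      ≡⟨ reassoc (+ o) (+ p) (+ n) ⟩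
  + o +ℤ (+ p -ℤ + n)      ∎
  where
  open ≡-Reasoning
  cancel : ∀ x y → x ≡ (x +ℤ y) -ℤ y
  cancel = ℤ-solve-∀
  reassoc : ∀ x y z → (x +ℤ y) -ℤ z ≡ x +ℤ (y -ℤ z)
  reassoc = ℤ-solve-∀

+[m+k]-+[n+k]≡+m-+n : ∀ m n k → + (m + k) -ℤ + (n + k) ≡ + m -ℤ + n
+[m+k]-+[n+k]≡+m-+n m n k = trans (cong₂ _-ℤ_ (ZP.pos-+ m k) (ZP.pos-+ n k)) (cancel (+ m) (+ n) (+ k))
  where
  cancel : ∀ x y z → (x +ℤ z) -ℤ (y +ℤ z) ≡ x -ℤ y
  cancel = ℤ-solve-∀

-- Monomials and their degrees

infixl 6 _⊞_

_⊞_ : Mon → Mon → Mon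
(m₁ , m₂ , m₃) ⊞ (β₁ , β₂ , β₃) = (m₁ + β₁ , m₂ + β₂ , m₃ + β₃)

wt : Mon → ℕ
wt (_ , α₂ , α₃) = α₂ + 2 * α₃

balanced : ℕ → ℕ → Mon
balanced t j = (t , 2 * j , t)

data Reduced : Mon → Set where
  xᵏyᵖ : ∀ {p} → p ≤ 1 → ∀ k → Reduced (k , p , 0)
  yᵖzᵏ : ∀ {p} → p ≤ 1 → ∀ k → Reduced (0 , p , k)

atLevel : ℕ → Mon → ℕ → ℕ
atLevel a m k = ev a m + (a + 1) * (2 * k)

ev≡len*a+wt : ∀ a α → ev a α ≡ len α * a + wt α
ev≡len*a+wt a (x , y , z) = identity a x y z
  where
  identity : ∀ a x y z → x * a + y * (a + 1) + z * (a + 2) ≡ (x + y + z) * a + (y + 2 * z)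
  identity = solve-∀

ev≤len*[a+2] : ∀ a α → ev a α ≤ len α * (a + 2)
ev≤len*[a+2] a (x , y , z) = subst (ev a (x , y , z) ≤_) (sym (identity a x y z)) (m≤m+n _ _)
  where
  identity : ∀ a x y z → (x + y + z) * (a + 2) ≡ (x * a + y * (a + 1) + z * (a + 2)) + (2 * x + y)
  identity = solve-∀

wt≤2*len : ∀ α → wt α ≤ 2 * len α
wt≤2*len (x , y , z) = subst (y + 2 * z ≤_) (sym (identity x y z)) (m≤m+n _ _)
  where
  identity : ∀ x y z → 2 * (x + y + z) ≡ (y + 2 * z) + (2 * x + y)
  identity = solve-∀

ev-⊞ : ∀ a m β → ev a (m ⊞ β) ≡ ev a m + ev a β
ev-⊞ a (m₁ , m₂ , m₃) (β₁ , β₂ , β₃) = identity a m₁ m₂ m₃ β₁ β₂ β₃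
  where
  identity : ∀ a m₁ m₂ m₃ β₁ β₂ β₃ →
    (m₁ + β₁) * a + (m₂ + β₂) * (a + 1) + (m₃ + β₃) * (a + 2)
      ≡ (m₁ * a + m₂ * (a + 1) + m₃ * (a + 2)) + (β₁ * a + β₂ * (a + 1) + β₃ * (a + 2))
  identity = solve-∀

ev-balanced : ∀ a t j → ev a (balanced t j) ≡ (a + 1) * (2 * (t + j))
ev-balanced a t j = identity a t j
  where
  identity : ∀ a t j → t * a + 2 * j * (a + 1) + t * (a + 2) ≡ (a + 1) * (2 * (t + j))
  identity = solve-∀

ev-decomposition : ∀ a m t j → ev a (m ⊞ balanced t j) ≡ atLevel a m (t + j)
ev-decomposition a m t j = trans (ev-⊞ a m (balanced t j)) (cong (λ n → ev a m + n) (ev-balanced a t j))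

len-decomposition : ∀ m t j → len (m ⊞ balanced t j) ≡ len m + 2 * (t + j)
len-decomposition (m₁ , m₂ , m₃) t j = identity m₁ m₂ m₃ t j
  where
  identity : ∀ m₁ m₂ m₃ t j → m₁ + t + (m₂ + 2 * j) + (m₃ + t) ≡ m₁ + m₂ + m₃ + 2 * (t + j)
  identity = solve-∀

wt-decomposition : ∀ m t j → wt (m ⊞ balanced t j) ≡ wt m + 2 * (t + j)
wt-decomposition (m₁ , m₂ , m₃) t j = identity m₂ m₃ t j
  where
  identity : ∀ m₂ m₃ t j → m₂ + 2 * j + 2 * (m₃ + t) ≡ m₂ + 2 * m₃ + 2 * (t + j)
  identity = solve-∀

atLevel≡[len+2k]*a+[wt+2k] : ∀ a m k → atLevel a m k ≡ (len m + 2 * k) * a + (wt m + 2 * k)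
atLevel≡[len+2k]*a+[wt+2k] a (m₁ , m₂ , m₃) k = identity a m₁ m₂ m₃ k
  where
  identity : ∀ a m₁ m₂ m₃ k → m₁ * a + m₂ * (a + 1) + m₃ * (a + 2) + (a + 1) * (2 * k)
                                ≡ (m₁ + m₂ + m₃ + 2 * k) * a + (m₂ + 2 * m₃ + 2 * k)
  identity = solve-∀

atLevel≤[len+2k]*[a+2] : ∀ a m k → atLevel a m k ≤ (len m + 2 * k) * (a + 2)
atLevel≤[len+2k]*[a+2] a m k =
  subst₂ _≤_ (ev-decomposition a m 0 k) (cong (_* (a + 2)) (len-decomposition m 0 k))
             (ev≤len*[a+2] a (m ⊞ balanced 0 k))

-- With n = len α: n < ℓ would give degree < ℓ a (as 2n < a), and n > ℓ would
-- give degree ≥ (ℓ + 1) a (as e < a).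
len-wt-determined : ∀ {a ℓ e} α → e < a → 2 * ℓ ≤ suc a → ev a α ≡ ℓ * a + e →
                    len α ≡ ℓ × wt α ≡ e
len-wt-determined {a} {ℓ} {e} α e<a 2ℓ≤1+a ev≡ =
  len≡ℓ , +-cancelˡ-≡ (ℓ * a) _ _ (trans (cong (λ n → n * a + wt α) (sym len≡ℓ))
                                         (trans (sym (ev≡len*a+wt a α)) ev≡))
  where
  open ≤-Reasoning
  n = len α
  n≤ℓ : n ≤ ℓ
  n≤ℓ = ≤-pred (*-cancelʳ-< a n (suc ℓ) (begin-strict
    n * a        ≤⟨ m≤m+n (n * a) (wt α) ⟩
    n * a + wt α ≡⟨ ev≡len*a+wt a α ⟨
    ev a α       ≡⟨ ev≡ ⟩
    ℓ * a + e    <⟨ +-monoʳ-< (ℓ * a) e<a ⟩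
    ℓ * a + a    ≡⟨ +-comm (ℓ * a) a ⟩
    suc ℓ * a    ∎))
  2n<a : n < ℓ → 2 * n < a
  2n<a n<ℓ = ≤-pred (begin
    2 + 2 * n ≡⟨ 2[1+k]≡2+2k n ⟨
    2 * suc n ≤⟨ *-monoʳ-≤ 2 n<ℓ ⟩
    2 * ℓ     ≤⟨ 2ℓ≤1+a ⟩
    suc a     ∎)
  ℓ≤n : ℓ ≤ n
  ℓ≤n = ≮⇒≥ λ n<ℓ → <-irrefl refl (begin-strict
    ℓ * a + e        ≡⟨ ev≡ ⟨
    ev a α           ≡⟨ ev≡len*a+wt a α ⟩
    n * a + wt α     ≤⟨ +-monoʳ-≤ (n * a) (wt≤2*len α) ⟩
    n * a + 2 * n    <⟨ +-monoʳ-< (n * a) (2n<a n<ℓ) ⟩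
    n * a + a        ≡⟨ +-comm (n * a) a ⟩
    suc n * a        ≤⟨ *-monoˡ-≤ a n<ℓ ⟩
    ℓ * a            ≤⟨ m≤m+n (ℓ * a) e ⟩
    ℓ * a + e        ∎)
  len≡ℓ : len α ≡ ℓ
  len≡ℓ = ≤-antisym n≤ℓ ℓ≤n

reduced-decomposition : ∀ α → Σ Mon λ m → Σ ℕ λ t → Σ ℕ λ j → Reduced m × α ≡ m ⊞ balanced t j
reduced-decomposition (x , y , z) with ≤-total x z
... | inj₁ x≤z = (0 , y % 2 , z ∸ x) , x , y / 2 , yᵖzᵏ (n%2≤1 y) (z ∸ x) ,
                 cong₂ _,_ refl (cong₂ _,_ (n≡n%2+2*[n/2] y) (sym (m∸n+n≡m x≤z)))
... | inj₂ z≤x = (x ∸ z , y % 2 , 0) , z , y / 2 , xᵏyᵖ (n%2≤1 y) (x ∸ z) ,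
                 cong₂ _,_ (sym (m∸n+n≡m z≤x)) (cong₂ _,_ (n≡n%2+2*[n/2] y) refl)

parity-unique : ∀ {p q h h′} → p ≤ 1 → q ≤ 1 → p + 2 * h ≡ q + 2 * h′ → p ≡ q × h ≡ h′
parity-unique {h = h} {h′} z≤n z≤n eq = refl , *-cancelˡ-≡ h h′ 2 eq
parity-unique {h = h} {h′} z≤n (s≤s z≤n) eq = ⊥-elim (even≢odd h h′ eq)
parity-unique {h = h} {h′} (s≤s z≤n) z≤n eq = ⊥-elim (even≢odd h′ h (sym eq))
parity-unique {h = h} {h′} (s≤s z≤n) (s≤s z≤n) eq = refl , *-cancelˡ-≡ h h′ 2 (suc-injective eq)

level-≤ : ∀ {x p z x′ z′ k k′} → Reduced (x , p , z) → x + k ≡ x′ + k′ → z + k ≡ z′ + k′ → k′ ≤ k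
level-≤ {z′ = z′} {k′ = k′} (xᵏyᵖ _ _) _ eq = subst (k′ ≤_) (sym eq) (m≤n+m k′ z′)
level-≤ {x′ = x′} {k′ = k′} (yᵖzᵏ _ _) eq _ = subst (k′ ≤_) (sym eq) (m≤n+m k′ x′)

Reduced⇒y≤1 : ∀ {x p z} → Reduced (x , p , z) → p ≤ 1
Reduced⇒y≤1 (xᵏyᵖ p≤1 _) = p≤1
Reduced⇒y≤1 (yᵖzᵏ p≤1 _) = p≤1

-- wt fixes p and z + k by parity, then len fixes x + k; as x or z vanishes, k is pinned.
reduced-unique : ∀ {m m′ k k′} → Reduced m → Reduced m′ →
                 len m + 2 * k ≡ len m′ + 2 * k′ → wt m + 2 * k ≡ wt m′ + 2 * k′ → m ≡ m′ × k ≡ k′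
reduced-unique {x , p , z} {x′ , p′ , z′} {k} {k′} r r′ len≡ wt≡ =
  cong₂ _,_ (+-cancelʳ-≡ k x x′ (trans x+k≡ (cong (λ l → x′ + l) (sym k≡k′))))
            (cong₂ _,_ p≡p′ (+-cancelʳ-≡ k z z′ (trans z+k≡ (cong (λ l → z′ + l) (sym k≡k′))))) ,
  k≡k′
  where
  wt-form : ∀ p z k → p + 2 * z + 2 * k ≡ p + 2 * (z + k)
  wt-form = solve-∀
  len-form : ∀ x p z k → x + p + z + 2 * k ≡ (x + k) + (p + (z + k))
  len-form = solve-∀
  parity = parity-unique (Reduced⇒y≤1 r) (Reduced⇒y≤1 r′)
             (trans (sym (wt-form p z k)) (trans wt≡ (wt-form p′ z′ k′)))
  p≡p′ = proj₁ parity
  z+k≡ : z + k ≡ z′ + k′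
  z+k≡ = proj₂ parity
  x+k≡ : x + k ≡ x′ + k′
  x+k≡ = +-cancelʳ-≡ (p + (z + k)) _ _ (begin
    x + k + (p + (z + k))     ≡⟨ len-form x p z k ⟨
    x + p + z + 2 * k         ≡⟨ len≡ ⟩
    x′ + p′ + z′ + 2 * k′     ≡⟨ len-form x′ p′ z′ k′ ⟩
    x′ + k′ + (p′ + (z′ + k′)) ≡⟨ cong₂ (λ q l → x′ + k′ + (q + l)) (sym p≡p′) (sym z+k≡) ⟩
    x′ + k′ + (p + (z + k))   ∎)
    where open ≡-Reasoning
  k≡k′ : k ≡ k′
  k≡k′ = ≤-antisym (level-≤ r′ (sym x+k≡) (sym z+k≡)) (level-≤ r x+k≡ z+k≡)

-- The constants L, D and 𝓛

2*L<a : ∀ {a} → 1 ≤ a → 2 * Lof a < a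
2*L<a {suc a} _ = s≤s (subst (_≤ a) (*-comm (a / 2) 2) (m/n*n≤m a 2))

a≤2*L+2 : ∀ a → a ≤ 2 * Lof a + 2
a≤2*L+2 zero = z≤n
a≤2*L+2 (suc a) = begin
  suc a                        ≡⟨ cong suc (n≡n%2+2*[n/2] a) ⟩
  suc (a % 2 + 2 * (a / 2))    ≤⟨ s≤s (+-monoˡ-≤ (2 * (a / 2)) (n%2≤1 a)) ⟩
  suc (1 + 2 * (a / 2))        ≡⟨ identity (a / 2) ⟩
  2 * (a / 2) + 2              ∎
  where
  open ≤-Reasoning
  identity : ∀ h → suc (1 + 2 * h) ≡ 2 * h + 2
  identity = solve-∀

half-≤ : ∀ {x y} → 2 * x ≤ 2 * y + 1 → x ≤ y
half-≤ {x} {y} le =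
  ≤-pred (*-cancelˡ-< 2 x (suc y) (≤-trans (s≤s le) (≤-reflexive (sym (identity y)))))
  where
  identity : ∀ y → 2 * suc y ≡ suc (2 * y + 1)
  identity = solve-∀

4*D≤a+3 : ∀ a → 2 * (2 * Dof a) ≤ a + 3
4*D≤a+3 a = subst (_≤ a + 3) (identity (Dof a)) (m/n*n≤m (a + 3) 4)
  where
  identity : ∀ D → D * 4 ≡ 2 * (2 * D)
  identity = solve-∀

2*D≤L+2 : ∀ a → 2 * Dof a ≤ Lof a + 2
2*D≤L+2 a = half-≤ (begin
  2 * (2 * Dof a)     ≤⟨ 4*D≤a+3 a ⟩
  a + 3               ≤⟨ +-monoˡ-≤ 3 (a≤2*L+2 a) ⟩
  2 * L + 2 + 3       ≡⟨ identity L ⟩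
  2 * (L + 2) + 1     ∎)
  where
  open ≤-Reasoning
  L = Lof a
  identity : ∀ L → 2 * L + 2 + 3 ≡ 2 * (L + 2) + 1
  identity = solve-∀

2*D<a : ∀ {a} → 3 ≤ a → 2 * Dof a < a
2*D<a {1} (s≤s ())
2*D<a {2} (s≤s (s≤s ()))
2*D<a {3} _ = ≤-refl
2*D<a {4} _ = n≤1+n 3
2*D<a {a@(suc (suc (suc (suc (suc b)))))} _ = s≤s (*-cancelˡ-≤ 2 (begin
  2 * (2 * Dof a) ≤⟨ 4*D≤a+3 a ⟩
  a + 3           ≤⟨ m≤m+n (a + 3) b ⟩
  a + 3 + b       ≡⟨ identity b ⟩
  2 * (4 + b)     ∎))
  where
  open ≤-Reasoning
  identity : ∀ b → 5 + b + 3 + b ≡ 2 * (4 + b)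
  identity = solve-∀

2*x≤L⇒x<D : ∀ {a x} → 1 ≤ a → 2 * x ≤ Lof a → x < Dof a
2*x≤L⇒x<D {a} {x} 1≤a 2x≤L = begin
  suc x               ≡⟨ m*n/n≡m (suc x) 4 ⟨
  suc x * 4 / 4       ≤⟨ /-monoˡ-≤ 4 (begin
    suc x * 4           ≡⟨ identity x ⟩
    2 * (2 * x) + 4     ≤⟨ +-monoˡ-≤ 4 (*-monoʳ-≤ 2 2x≤L) ⟩
    2 * Lof a + 4       ≡⟨ +-suc (2 * Lof a) 3 ⟩
    suc (2 * Lof a) + 3 ≤⟨ +-monoˡ-≤ 3 (2*L<a 1≤a) ⟩
    a + 3               ∎) ⟩
  (a + 3) / 4         ∎
  where
  open ≤-Reasoning
  identity : ∀ x → suc x * 4 ≡ 2 * (2 * x) + 4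
  identity = solve-∀

[a+2]*L<𝓛 : ∀ {a} → 1 ≤ a → (a + 2) * Lof a < 𝓛 a
[a+2]*L<𝓛 {a} 1≤a with a % 2 ≟ 0
... | yes even rewrite dec-true (a % 2 ≟ 0) even = begin-strict
  (a + 2) * L       <⟨ *-monoʳ-< (a + 2) {{>-nonZero (≤-trans 1≤a (m≤m+n a 2))}} L<a/2 ⟩
  (a + 2) * (a / 2) ≡⟨ *-comm (a + 2) (a / 2) ⟩
  a / 2 * (a + 2)   ∎
  where
  open ≤-Reasoning
  L = Lof a
  L<a/2 : L < a / 2
  L<a/2 = *-cancelʳ-< 2 L (a / 2) (begin-strict
    L * 2             ≡⟨ *-comm L 2 ⟩
    2 * L             <⟨ 2*L<a 1≤a ⟩
    a                 ≡⟨ m≡m%n+[m/n]*n a 2 ⟩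
    a % 2 + a / 2 * 2 ≡⟨ cong (_+ a / 2 * 2) even ⟩
    a / 2 * 2         ∎)
... | no odd rewrite dec-false (a % 2 ≟ 0) odd = begin-strict
  (a + 2) * L      ≡⟨ identity a L ⟩
  L * a + 2 * L    <⟨ +-monoʳ-< (L * a) (<-≤-trans (2*L<a 1≤a) (m≤n*m a 2)) ⟩
  L * a + 2 * a    ≡⟨ *-distribʳ-+ a L 2 ⟨
  (L + 2) * a      ≤⟨ *-monoˡ-≤ a (+-monoˡ-≤ 2 (/-monoˡ-≤ 2 (m∸n≤m a 1))) ⟩
  (a / 2 + 2) * a  ∎
  where
  open ≤-Reasoning
  L = Lof a
  identity : ∀ a L → (a + 2) * L ≡ L * a + 2 * L
  identity = solve-∀

-- Factorizations of atLevel a m k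

-- Makes len m + 2k and wt m + 2k the quotient and remainder of atLevel a m k
-- by a, so that len-wt-determined applies.
record Bounded (a : ℕ) (m : Mon) (k : ℕ) : Set where
  constructor bounded
  field
    wt+2k<a       : wt m + 2 * k < a
    2[len+2k]≤1+a : 2 * (len m + 2 * k) ≤ suc a

short⇒Bounded : ∀ {a} m k → 2 * (len m + 2 * k) < a → Bounded a m k
short⇒Bounded m k 2ℓ<a = bounded (≤-<-trans e≤2ℓ 2ℓ<a) (≤-trans (<⇒≤ 2ℓ<a) (n≤1+n _))
  where
  open ≤-Reasoning
  e≤2ℓ : wt m + 2 * k ≤ 2 * (len m + 2 * k)
  e≤2ℓ = begin
    wt m + 2 * k                ≤⟨ +-mono-≤ (wt≤2*len m) (m≤n+m (2 * k) (2 * k)) ⟩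
    2 * len m + (2 * k + 2 * k) ≡⟨ identity (len m) k ⟩
    2 * (len m + 2 * k)         ∎
    where
    identity : ∀ n k → 2 * n + (2 * k + 2 * k) ≡ 2 * (n + 2 * k)
    identity = solve-∀

factorization-shape : ∀ {a m k} → Reduced m → Bounded a m k → ∀ α → ev a α ≡ atLevel a m k →
                      Σ ℕ λ t → t ≤ k × α ≡ m ⊞ balanced t (k ∸ t)
factorization-shape {a} {m} {k} rm (bounded e<a 2ℓ≤1+a) α ev≡ with reduced-decomposition α
... | m′ , t , j , rm′ , refl =
  t , subst (t ≤_) t+j≡k (m≤m+n t j) ,
  cong₂ (λ μ l → μ ⊞ balanced t l) m′≡m (trans (sym (m+n∸m≡n t j)) (cong (_∸ t) t+j≡k))
  where
  len-wt = len-wt-determined (m′ ⊞ balanced t j) e<a 2ℓ≤1+a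
             (trans ev≡ (atLevel≡[len+2k]*a+[wt+2k] a m k))
  unique = reduced-unique rm′ rm (trans (sym (len-decomposition m′ t j)) (proj₁ len-wt))
                                 (trans (sym (wt-decomposition m′ t j)) (proj₂ len-wt))
  m′≡m = proj₁ unique
  t+j≡k = proj₂ unique

Fact-≡ : ∀ {a r} {f g : Fact a r} → proj₁ f ≡ proj₁ g → f ≡ g
Fact-≡ {f = α , p} {.α , q} refl = cong (α ,_) (≡-irrelevant p q)

⊞-balanced-injective : ∀ m k {t t′} → m ⊞ balanced t (k ∸ t) ≡ m ⊞ balanced t′ (k ∸ t′) → t ≡ t′
⊞-balanced-injective (m₁ , _ , _) _ eq = +-cancelˡ-≡ m₁ _ _ (cong proj₁ eq)

atLevel-card : ∀ {a m k} → Reduced m → Bounded a m k → Fin (suc k) ↔ Fact a (atLevel a m k)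
atLevel-card {a} {m} {k} rm bd = mk↔ₛ′ to from to∘from from∘to
  where
  factorization : ∀ t → t ≤ k → Fact a (atLevel a m k)
  factorization t t≤k = m ⊞ balanced t (k ∸ t) ,
    trans (ev-decomposition a m t (k ∸ t)) (cong (atLevel a m) (m+[n∸m]≡n t≤k))
  to : Fin (suc k) → Fact a (atLevel a m k)
  to i = factorization (toℕ i) (≤-pred (toℕ<n i))
  shape : (f : Fact a (atLevel a m k)) → Σ ℕ λ t → t ≤ k × proj₁ f ≡ m ⊞ balanced t (k ∸ t)
  shape (α , p) = factorization-shape rm bd α p
  from : Fact a (atLevel a m k) → Fin (suc k)
  from f = fromℕ< (s≤s (proj₁ (proj₂ (shape f))))
  to∘from : ∀ f → to (from f) ≡ f
  to∘from f = Fact-≡ (trans (cong (λ t → m ⊞ balanced t (k ∸ t)) (toℕ-fromℕ< _))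
                            (sym (proj₂ (proj₂ (shape f)))))
  from∘to : ∀ i → from (to i) ≡ i
  from∘to i = toℕ-injective
    (trans (toℕ-fromℕ< _) (sym (⊞-balanced-injective m k (proj₂ (proj₂ (shape (to i)))))))

Fin-↔-injective : ∀ {n n′} {A : Set} → Fin n ↔ A → Fin n′ ↔ A → n ≡ n′
Fin-↔-injective e e′ =
  cantor-schröder-bernstein (Injection.injective (↔⇒↣ f)) (Injection.injective (↔⇒↣ (↔-sym f)))
  where f = ↔-trans e (↔-sym e′)

atLevel-Sd×Sℓ : ∀ {a m k} → Reduced m → Bounded a m k →
                InSd a (suc k) (atLevel a m k) × InSℓ a (len m + 2 * k) (atLevel a m k)
atLevel-Sd×Sℓ {a} {m} {k} rm bd@(bounded e<a 2ℓ≤1+a) = (r∈S , card) , r∈S , λ α p →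
  proj₁ (len-wt-determined α e<a 2ℓ≤1+a (trans p (atLevel≡[len+2k]*a+[wt+2k] a m k)))
  where
  card = atLevel-card rm bd
  r∈S = Inverse.to card zero

ev≤[a+2]*L⇒len≤L : ∀ {a} α → 1 ≤ a → ev a α ≤ (a + 2) * Lof a → len α ≤ Lof a
ev≤[a+2]*L⇒len≤L {a} α 1≤a ev≤ = ≤-pred (*-cancelʳ-< a (len α) (suc L) (begin-strict
  len α * a         ≤⟨ m≤m+n (len α * a) (wt α) ⟩
  len α * a + wt α  ≡⟨ ev≡len*a+wt a α ⟨
  ev a α            ≤⟨ ev≤ ⟩
  (a + 2) * L       ≡⟨ identity a L ⟩
  L * a + 2 * L     <⟨ +-monoʳ-< (L * a) (2*L<a 1≤a) ⟩
  L * a + a         ≡⟨ +-comm (L * a) a ⟩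
  suc L * a         ∎))
  where
  open ≤-Reasoning
  L = Lof a
  identity : ∀ a L → (a + 2) * L ≡ L * a + 2 * L
  identity = solve-∀

short⇒atLevel : ∀ {a} α → 1 ≤ a → len α ≤ Lof a →
  Σ Mon λ m → Σ ℕ λ k → Reduced m × Bounded a m k × ev a α ≡ atLevel a m k × len α ≡ len m + 2 * k
short⇒atLevel {a} α 1≤a len≤L with reduced-decomposition α
... | m , t , j , rm , refl = m , t + j , rm , bd , ev-decomposition a m t j , len-decomposition m t j
  where
  bd = short⇒Bounded m (t + j)
         (≤-<-trans (*-monoʳ-≤ 2 (subst (_≤ Lof a) (len-decomposition m t j) len≤L)) (2*L<a 1≤a))

short⇒Sd×Sℓ : ∀ {a r} α → ev a α ≡ r → 1 ≤ a → len α ≤ Lof a →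
              Σ ℕ λ k → 2 * k ≤ len α × InSd a (suc k) r × InSℓ a (len α) r
short⇒Sd×Sℓ {a} α refl 1≤a len≤L with short⇒atLevel α 1≤a len≤L
... | m , k , rm , bd , ev≡ , len≡ =
  k , subst (2 * k ≤_) (sym len≡) (m≤n+m (2 * k) (len m)) ,
  subst₂ (λ r ℓ → InSd a (suc k) r × InSℓ a ℓ r) (sym ev≡) (sym len≡) (atLevel-Sd×Sℓ rm bd)

Sd⇒atLevel : ∀ {a k r} → InSd a (suc k) r → ∀ α → ev a α ≡ r → 1 ≤ a → len α ≤ Lof a →
             Σ Mon λ m → Reduced m × len α ≡ len m + 2 * k × r ≡ atLevel a m k
Sd⇒atLevel {a} {k} (_ , card) α refl 1≤a len≤L with short⇒atLevel α 1≤a len≤L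
... | m , k′ , rm , bd , ev≡ , len≡ =
  m , rm , subst (λ l → len α ≡ len m + 2 * l) (sym k≡k′) len≡ ,
  subst (λ l → ev a α ≡ atLevel a m l) (sym k≡k′) ev≡
  where
  k≡k′ : k ≡ k′
  k≡k′ = suc-injective (Fin-↔-injective card
           (subst (λ r → Fin (suc k′) ↔ Fact a r) (sym ev≡) (atLevel-card rm bd)))

S∩[0,[a+2]L] : ∀ {a} → 1 ≤ a → ∀ r → (InS a r × r ≤ (a + 2) * Lof a)
               ⟺ (Σ ℕ (λ d′ → 1 ≤ d′ × d′ ≤ Dof a × InSd a d′ r) × InUnionSℓ a r)
S∩[0,[a+2]L] {a} 1≤a r = fwd , bwd
  where
  fwd : InS a r × r ≤ (a + 2) * Lof a → Σ ℕ (λ d′ → 1 ≤ d′ × d′ ≤ Dof a × InSd a d′ r) × InUnionSℓ a r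
  fwd ((α , p) , r≤) with ev≤[a+2]*L⇒len≤L α 1≤a (subst (_≤ (a + 2) * Lof a) (sym p) r≤)
  ... | len≤L with short⇒Sd×Sℓ α p 1≤a len≤L
  ... | k , 2k≤len , sd , sℓ =
    (suc k , s≤s z≤n , 2*x≤L⇒x<D 1≤a (≤-trans 2k≤len len≤L) , sd) , len α , len≤L , sℓ
  bwd : Σ ℕ (λ d′ → 1 ≤ d′ × d′ ≤ Dof a × InSd a d′ r) × InUnionSℓ a r → InS a r × r ≤ (a + 2) * Lof a
  bwd (_ , l , l≤L , (α , p) , len≡) = (α , p) , (begin
    r                 ≡⟨ p ⟨
    ev a α            ≤⟨ ev≤len*[a+2] a α ⟩
    len α * (a + 2)   ≡⟨ cong (_* (a + 2)) (len≡ α p) ⟩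
    l * (a + 2)       ≤⟨ *-monoˡ-≤ (a + 2) l≤L ⟩
    Lof a * (a + 2)   ≡⟨ *-comm (Lof a) (a + 2) ⟩
    (a + 2) * Lof a   ∎)
    where open ≤-Reasoning

-- The sets S_{d,i}

-- The offset c of S_{d,i}: atLevel a m k = (a + 1)(2k + len m) + cOf m, see atLevel-ℤ.
cOf : Mon → ℤ
cOf (m₁ , _ , m₃) = + m₃ -ℤ + m₁

atLevel-ℤ : ∀ a m k → + atLevel a m k ≡ + ((a + 1) * ((2 * suc k ∸ 2) + len m)) +ℤ cOf m
atLevel-ℤ a (m₁ , m₂ , m₃) k = m+n≡o+p⇒+m≡+o+[+p-+n] (begin
  atLevel a (m₁ , m₂ , m₃) k + m₁         ≡⟨ identity a m₁ m₂ m₃ k ⟩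
  (a + 1) * (2 * k + n) + m₃             ≡⟨ cong (λ l → (a + 1) * (l + n) + m₃) (2[1+k]∸2≡2k k) ⟨
  (a + 1) * ((2 * suc k ∸ 2) + n) + m₃   ∎)
  where
  open ≡-Reasoning
  n = m₁ + m₂ + m₃
  identity : ∀ a m₁ m₂ m₃ k → m₁ * a + m₂ * (a + 1) + m₃ * (a + 2) + (a + 1) * (2 * k) + m₁
                                ≡ (a + 1) * (2 * k + (m₁ + m₂ + m₃)) + m₃
  identity = solve-∀

Γ-xᵏ : ∀ k → Γ k (- + k)
Γ-xᵏ zero = refl
Γ-xᵏ (suc zero) = inj₁ refl
Γ-xᵏ (suc (suc k)) = inj₁ refl

Γ-xᵏy : ∀ k → Γ (suc k) (- + k)
Γ-xᵏy zero = inj₂ (inj₁ refl)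
Γ-xᵏy (suc k) = inj₂ (inj₁ refl)

Γ-zᵏ : ∀ k → Γ k (+ k)
Γ-zᵏ zero = refl
Γ-zᵏ (suc zero) = inj₂ (inj₂ refl)
Γ-zᵏ (suc (suc k)) = inj₂ (inj₂ (inj₂ refl))

Γ-yzᵏ : ∀ k → Γ (suc k) (+ k)
Γ-yzᵏ zero = inj₂ (inj₁ refl)
Γ-yzᵏ (suc k) = inj₂ (inj₂ (inj₁ refl))

Γ-reduced : ∀ {m} → Reduced m → Γ (len m) (cOf m)
Γ-reduced (xᵏyᵖ z≤n k) =
  subst₂ Γ (sym (trans (+-identityʳ (k + 0)) (+-identityʳ k))) (sym (ZP.+-identityˡ _)) (Γ-xᵏ k)
Γ-reduced (xᵏyᵖ (s≤s z≤n) k) =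
  subst₂ Γ (sym (trans (+-identityʳ (k + 1)) (+-comm k 1))) (sym (ZP.+-identityˡ _)) (Γ-xᵏy k)
Γ-reduced (yᵖzᵏ z≤n k) = subst (Γ k) (sym (ZP.+-identityʳ _)) (Γ-zᵏ k)
Γ-reduced (yᵖzᵏ (s≤s z≤n) k) = subst (Γ (suc k)) (sym (ZP.+-identityʳ _)) (Γ-yzᵏ k)

reduced-of-Γ : ∀ {i c} → Γ i c → Σ Mon λ m → Reduced m × len m ≡ i × cOf m ≡ c
reduced-of-Γ {zero} refl = (0 , 0 , 0) , xᵏyᵖ z≤n 0 , refl , refl
reduced-of-Γ {suc zero} (inj₁ refl) = (1 , 0 , 0) , xᵏyᵖ z≤n 1 , refl , refl
reduced-of-Γ {suc zero} (inj₂ (inj₁ refl)) = (0 , 1 , 0) , xᵏyᵖ (s≤s z≤n) 0 , refl , refl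
reduced-of-Γ {suc zero} (inj₂ (inj₂ refl)) = (0 , 0 , 1) , yᵖzᵏ z≤n 1 , refl , refl
reduced-of-Γ {suc (suc k)} (inj₁ refl) =
  (2 + k , 0 , 0) , xᵏyᵖ z≤n (2 + k) , trans (+-identityʳ (2 + k + 0)) (+-identityʳ (2 + k)) , refl
reduced-of-Γ {suc (suc k)} (inj₂ (inj₁ refl)) =
  (1 + k , 1 , 0) , xᵏyᵖ (s≤s z≤n) (1 + k) ,
  trans (+-identityʳ (1 + k + 1)) (cong suc (+-comm k 1)) , refl
reduced-of-Γ {suc (suc k)} (inj₂ (inj₂ (inj₁ refl))) =
  (0 , 1 , 1 + k) , yᵖzᵏ (s≤s z≤n) (1 + k) , refl , ZP.+-identityʳ _
reduced-of-Γ {suc (suc k)} (inj₂ (inj₂ (inj₂ refl))) =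
  (0 , 0 , 2 + k) , yᵖzᵏ z≤n (2 + k) , refl , ZP.+-identityʳ _

-- For each c ∈ Γ_i this computes to the monomial x^i, x^(i-1) y, y z^(i-1), z^i
-- (or 1, x, y, z) attached to c in (6) and (7).
monomialOf : ∀ {i c} → Γ i c → Mon
monomialOf γ = proj₁ (reduced-of-Γ γ)

Sdi⇒atLevel : ∀ {a k i r} → InSdi a (suc k) i r → Σ Mon λ m → Reduced m × len m ≡ i × r ≡ + atLevel a m k
Sdi⇒atLevel {a} {k} (c , γ , r≡) with reduced-of-Γ γ
... | m , rm , refl , refl = m , rm , refl , trans r≡ (sym (atLevel-ℤ a m k))

atLevel⇒Sdi : ∀ {a k m} → Reduced m → InSdi a (suc k) (len m) (+ atLevel a m k)
atLevel⇒Sdi {a} {k} {m} rm = cOf m , Γ-reduced rm , atLevel-ℤ a m k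

-- The quotient and remainder of r by a are ℓ = len m + 2k and e = p + 2(z + k),
-- so φ_r is m ⊞ (xz)^k and c_r = (z + k) - (x + k).
cr-atLevel : ∀ {a m k} .{{_ : NonZero a}} → Reduced m → Bounded a m k → cr a (atLevel a m k) ≡ cOf m
cr-atLevel {a} {x , p , z} {k} rm (bounded e<a _) = begin
  cr a r                                         ≡⟨⟩
  + ((r % a) / 2) -ℤ + (r / a ∸ (r % a + 1) / 2) ≡⟨ cong₂ (λ e q → + (e / 2) -ℤ + (q ∸ (e + 1) / 2)) r%a≡e r/a≡ℓ ⟩
  + (e / 2) -ℤ + (ℓ ∸ (e + 1) / 2)               ≡⟨ cong₂ (λ h q → + h -ℤ + (ℓ ∸ q)) e/2 [e+1]/2 ⟩
  + (z + k) -ℤ + (ℓ ∸ (p + (z + k)))             ≡⟨ cong (λ q → + (z + k) -ℤ + q) ℓ∸[p+z+k]≡x+k ⟩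
  + (z + k) -ℤ + (x + k)                         ≡⟨ +[m+k]-+[n+k]≡+m-+n z x k ⟩
  + z -ℤ + x                                     ∎
  where
  open ≡-Reasoning
  r = atLevel a (x , p , z) k
  ℓ = len (x , p , z) + 2 * k
  e = wt (x , p , z) + 2 * k
  e-split : ∀ p z k → p + 2 * z + 2 * k ≡ p + 2 * (z + k)
  e-split = solve-∀
  ℓ-split : ∀ x p z k → x + p + z + 2 * k ≡ (x + k) + (p + (z + k))
  ℓ-split = solve-∀
  r/a≡ℓ : r / a ≡ ℓ
  r/a≡ℓ = trans (cong (_/ a) (atLevel≡[len+2k]*a+[wt+2k] a (x , p , z) k)) ([qn+r]/n≡q ℓ e<a)
  r%a≡e : r % a ≡ e
  r%a≡e = trans (cong (_% a) (atLevel≡[len+2k]*a+[wt+2k] a (x , p , z) k)) ([qn+r]%n≡r ℓ e<a)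
  e/2 : e / 2 ≡ z + k
  e/2 = trans (cong (_/ 2) (e-split p z k)) ([p+2h]/2≡h (z + k) (Reduced⇒y≤1 rm))
  [e+1]/2 : (e + 1) / 2 ≡ p + (z + k)
  [e+1]/2 = trans (cong (λ l → (l + 1) / 2) (e-split p z k)) ([p+2h+1]/2≡p+h (z + k) (Reduced⇒y≤1 rm))
  ℓ∸[p+z+k]≡x+k : ℓ ∸ (p + (z + k)) ≡ x + k
  ℓ∸[p+z+k]≡x+k = trans (cong (_∸ (p + (z + k))) (ℓ-split x p z k)) (m+n∸n≡m (x + k) (p + (z + k)))

wt-ℤ : ∀ m → + wt m ≡ + len m +ℤ cOf m
wt-ℤ (m₁ , m₂ , m₃) = m+n≡o+p⇒+m≡+o+[+p-+n] (identity m₁ m₂ m₃)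
  where
  identity : ∀ m₁ m₂ m₃ → m₂ + 2 * m₃ + m₁ ≡ m₁ + m₂ + m₃ + m₃
  identity = solve-∀

cOf-injective : ∀ {m m′} → Reduced m → Reduced m′ → len m ≡ len m′ → cOf m ≡ cOf m′ → m ≡ m′
cOf-injective {m} {m′} rm rm′ len≡ cOf≡ =
  proj₁ (reduced-unique {k = 0} {0} rm rm′ (cong (_+ 0) len≡) (cong (_+ 0) wt≡))
  where
  wt≡ : wt m ≡ wt m′
  wt≡ = ZP.+-injective (trans (wt-ℤ m) (trans (cong₂ _+ℤ_ (cong +_ len≡) cOf≡) (sym (wt-ℤ m′))))

-- Multiplying spans by a monomial

⊞-cancelˡ : ∀ m {β γ} → m ⊞ β ≡ m ⊞ γ → β ≡ γ
⊞-cancelˡ (m₁ , m₂ , m₃) {β₁ , β₂ , β₃} {γ₁ , γ₂ , γ₃} eq =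
  cong₂ _,_ (+-cancelˡ-≡ m₁ _ _ (cong proj₁ eq))
            (cong₂ _,_ (+-cancelˡ-≡ m₂ _ _ (cong (proj₁ ∘ proj₂) eq))
                       (+-cancelˡ-≡ m₃ _ _ (cong (proj₂ ∘ proj₂) eq)))

Shifted : Mon → (Mon → Set) → Mon → Set
Shifted m Q α = Σ Mon λ β → Q β × α ≡ m ⊞ β

module Shift {c ℓ : Level} (K : Field c ℓ) where
  open Poly K
  open Field K using (Carrier; _≈_; 0#; _⊕_)
  open CommutativeRing (Field.commutativeRing K) using ()
    renaming ( +-identityˡ to ⊕-identityˡ; +-cong to ⊕-cong
             ; refl to ≈-refl; sym to ≈-sym; trans to ≈-trans; reflexive to ≈-reflexive)

  ⊞-view : ∀ m γ → (Σ Mon λ δ → γ ≡ m ⊞ δ) ⊎ (∀ δ → γ ≢ m ⊞ δ)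
  ⊞-view (m₁ , m₂ , m₃) (γ₁ , γ₂ , γ₃) with m₁ ≤? γ₁ | m₂ ≤? γ₂ | m₃ ≤? γ₃
  ... | yes p₁ | yes p₂ | yes p₃ =
    inj₁ (_ , sym (cong₂ _,_ (m+[n∸m]≡n p₁) (cong₂ _,_ (m+[n∸m]≡n p₂) (m+[n∸m]≡n p₃))))
  ... | no ¬p₁ | _ | _ = inj₂ λ { _ refl → ¬p₁ (m≤m+n _ _) }
  ... | yes _ | no ¬p₂ | _ = inj₂ λ { _ refl → ¬p₂ (m≤m+n _ _) }
  ... | yes _ | yes _ | no ¬p₃ = inj₂ λ { _ refl → ¬p₃ (m≤m+n _ _) }

  mulMon-⊞ : ∀ m f δ → mulMon m f (m ⊞ δ) ≡ f δ
  mulMon-⊞ (m₁ , m₂ , m₃) f (δ₁ , δ₂ , δ₃)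
    rewrite dec-true (m₁ ≤? m₁ + δ₁) (m≤m+n m₁ δ₁) | dec-true (m₂ ≤? m₂ + δ₂) (m≤m+n m₂ δ₂)
          | dec-true (m₃ ≤? m₃ + δ₃) (m≤m+n m₃ δ₃)
          | m+n∸m≡n m₁ δ₁ | m+n∸m≡n m₂ δ₂ | m+n∸m≡n m₃ δ₃ = refl

  mulMon-∉ : ∀ m f γ → (∀ δ → γ ≢ m ⊞ δ) → mulMon m f γ ≡ 0#
  mulMon-∉ (m₁ , m₂ , m₃) f (γ₁ , γ₂ , γ₃) ∉ with m₁ ≤? γ₁ | m₂ ≤? γ₂ | m₃ ≤? γ₃
  ... | no ¬p₁ | _ | _ rewrite dec-false (m₁ ≤? γ₁) ¬p₁ = refl
  ... | yes p₁ | no ¬p₂ | _ rewrite dec-true (m₁ ≤? γ₁) p₁ | dec-false (m₂ ≤? γ₂) ¬p₂ = refl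
  ... | yes p₁ | yes p₂ | no ¬p₃
    rewrite dec-true (m₁ ≤? γ₁) p₁ | dec-true (m₂ ≤? γ₂) p₂ | dec-false (m₃ ≤? γ₃) ¬p₃ = refl
  ... | yes p₁ | yes p₂ | yes p₃ =
    ⊥-elim (∉ _ (sym (cong₂ _,_ (m+[n∸m]≡n p₁) (cong₂ _,_ (m+[n∸m]≡n p₂) (m+[n∸m]≡n p₃)))))

  private
    shift : Mon → List (Carrier × Mon) → List (Carrier × Mon)
    shift m = map (map₂ (m ⊞_))

  terms-⊞ : ∀ m ts δ → terms (shift m ts) (m ⊞ δ) ≡ terms ts δ
  terms-⊞ m [] δ = refl
  terms-⊞ m ((k , β) ∷ ts) δ =
    cong₂ (λ b s → (if b then k else 0#) ⊕ s)
          (does-≡ ((m ⊞ β) ≟M (m ⊞ δ)) (map′ (cong (m ⊞_)) (⊞-cancelˡ m) (β ≟M δ)))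
          (terms-⊞ m ts δ)

  terms-∉ : ∀ m ts γ → (∀ δ → γ ≢ m ⊞ δ) → terms (shift m ts) γ ≈ 0#
  terms-∉ m [] γ ∉ = ≈-refl
  terms-∉ m ((k , β) ∷ ts) γ ∉ = ≈-trans
    (⊕-cong (≈-reflexive (cong (λ b → if b then k else 0#) (dec-false ((m ⊞ β) ≟M γ) (∉ β ∘ sym))))
            (terms-∉ m ts γ ∉))
    (⊕-identityˡ 0#)

  mulMon-terms : ∀ m ts γ → mulMon m (terms ts) γ ≈ terms (shift m ts) γ
  mulMon-terms m ts γ with ⊞-view m γ
  ... | inj₁ (δ , refl) = ≈-reflexive (trans (mulMon-⊞ m (terms ts) δ) (sym (terms-⊞ m ts δ)))
  ... | inj₂ ∉ = ≈-trans (≈-reflexive (mulMon-∉ m (terms ts) γ ∉)) (≈-sym (terms-∉ m ts γ ∉))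

  mulMon-cong : ∀ m {f g} → (∀ β → f β ≈ g β) → ∀ γ → mulMon m f γ ≈ mulMon m g γ
  mulMon-cong m {f} {g} f≈g γ with ⊞-view m γ
  ... | inj₁ (δ , refl) =
    ≈-trans (≈-reflexive (mulMon-⊞ m f δ)) (≈-trans (f≈g δ) (≈-reflexive (sym (mulMon-⊞ m g δ))))
  ... | inj₂ ∉ = ≈-reflexive (trans (mulMon-∉ m f γ ∉) (sym (mulMon-∉ m g γ ∉)))

  span-mono : ∀ {P Q : Mon → Set} → (∀ α → P α → Q α) → ∀ f → InSpan P f → InSpan Q f
  span-mono P⊆Q f (ts , ps , f≈) = ts , All.map (P⊆Q _) ps , f≈

  span-cong : ∀ {P Q : Mon → Set} → (∀ α → P α ⟺ Q α) → SameSet (InSpan P) (InSpan Q)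
  span-cong P⇔Q f = span-mono (proj₁ ∘ P⇔Q) f , span-mono (proj₂ ∘ P⇔Q) f

  span-Shifted : ∀ m Q → SameSet (InSpan (Shifted m Q)) (InMulW m (InSpan Q))
  span-Shifted m Q g = fwd , bwd
    where
    unshift : ∀ {ts} → All (Shifted m Q ∘ proj₂) ts →
              Σ (List (Carrier × Mon)) λ us → All (Q ∘ proj₂) us × shift m us ≡ ts
    unshift [] = [] , [] , refl
    unshift {(k , _) ∷ _} ((β , q , refl) ∷ ps) with unshift ps
    ... | us , qs , refl = (k , β) ∷ us , q ∷ qs , refl
    fwd : InSpan (Shifted m Q) g → InMulW m (InSpan Q) g
    fwd (ts , ps , g≈) with unshift ps
    ... | us , qs , refl =
      terms us , (us , qs , λ _ → ≈-refl) , λ γ → ≈-trans (g≈ γ) (≈-sym (mulMon-terms m us γ))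
    bwd : InMulW m (InSpan Q) g → InSpan (Shifted m Q) g
    bwd (f , (ts , qs , f≈) , g≈) =
      shift m ts , All.map⁺ (All.map (λ {t} q → proj₂ t , q , refl) qs) ,
      λ γ → ≈-trans (g≈ γ) (≈-trans (mulMon-cong m f≈ γ) (mulMon-terms m ts γ))

  span-shift : ∀ {P Q : Mon → Set} m → (∀ α → P α ⟺ Shifted m Q α) →
               SameSet (InSpan P) (InMulW m (InSpan Q))
  span-shift {Q = Q} m P⇔ f = proj₁ (span-Shifted m Q f) ∘ proj₁ (span-cong P⇔ f) ,
                              proj₂ (span-cong P⇔ f) ∘ proj₂ (span-Shifted m Q f)

module _ {c ℓ : Level} (K : Field c ℓ) where
  open Poly K
  open Shift K

  W-atLevel : ∀ {a m k} → Reduced m → Bounded a m k →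
              SameSet (InW a (atLevel a m k)) (InMulW m (InW a (atLevel a (0 , 0 , 0) k)))
  W-atLevel {a} {m} {k} rm bd = span-shift m λ α → shape α , unshape α
    where
    shape : ∀ α → InF a (atLevel a m k) α → Shifted m (InF a (atLevel a (0 , 0 , 0) k)) α
    shape α p with factorization-shape rm bd α p
    ... | t , t≤k , α≡ = balanced t (k ∸ t) ,
      trans (ev-balanced a t (k ∸ t)) (cong (λ l → (a + 1) * (2 * l)) (m+[n∸m]≡n t≤k)) , α≡
    unshape : ∀ α → Shifted m (InF a (atLevel a (0 , 0 , 0) k)) α → InF a (atLevel a m k) α
    unshape _ (β , q , refl) = trans (ev-⊞ a m β) (cong (λ n → ev a m + n) q)

-- k = d - 1 is the level: r_d = atLevel a (0 , 0 , 0) k.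
module Corollary (a k : ℕ) .{{_ : NonZero a}} (3≤a : 3 ≤ a) (k<D : suc k ≤ Dof a) where
  L = Lof a
  I = Iof a (suc k)

  1≤a : 1 ≤ a
  1≤a = ≤-trans (s≤s z≤n) 3≤a

  2[1+k]≤L+2 : 2 * suc k ≤ L + 2
  2[1+k]≤L+2 = ≤-trans (*-monoʳ-≤ 2 k<D) (2*D≤L+2 a)

  2k≤L : 2 * k ≤ L
  2k≤L = +-cancelˡ-≤ 2 (2 * k) L (subst₂ _≤_ (2[1+k]≡2+2k k) (+-comm L 2) 2[1+k]≤L+2)

  level≡ : ∀ n → (2 * suc k ∸ 2) + n ≡ n + 2 * k
  level≡ n = trans (cong (_+ n) (2[1+k]∸2≡2k k)) (+-comm (2 * k) n)

  I≡L∸2k : I ≡ L ∸ 2 * k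
  I≡L∸2k = cong₂ _∸_ (+-comm L 2) (2[1+k]≡2+2k k)

  rd≡ : rof a (suc k) ≡ atLevel a (0 , 0 , 0) k
  rd≡ = cong ((a + 1) *_) (2[1+k]∸2≡2k k)

  i≤I⇒i+2k≤L : ∀ {i} → i ≤ I → i + 2 * k ≤ L
  i≤I⇒i+2k≤L {i} i≤I = begin
    i + 2 * k          ≤⟨ +-monoˡ-≤ (2 * k) (subst (i ≤_) I≡L∸2k i≤I) ⟩
    (L ∸ 2 * k) + 2 * k ≡⟨ m∸n+n≡m 2k≤L ⟩
    L                  ∎
    where open ≤-Reasoning

  i+2k≤L⇒i≤I : ∀ {i} → i + 2 * k ≤ L → i ≤ I
  i+2k≤L⇒i≤I {i} le = subst (i ≤_) (sym I≡L∸2k) (m+n≤o⇒m≤o∸n i le)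

  ≤L⇒Bounded : ∀ m → len m + 2 * k ≤ L → Bounded a m k
  ≤L⇒Bounded m le = short⇒Bounded m k (≤-<-trans (*-monoʳ-≤ 2 le) (2*L<a 1≤a))

  len≡1⇒Bounded : ∀ {m} → len m ≡ 1 → Bounded a m k
  len≡1⇒Bounded {m} len≡1 = bounded e<a 2ℓ≤1+a
    where
    open ≤-Reasoning
    e<a : wt m + 2 * k < a
    e<a = begin-strict
      wt m + 2 * k        ≤⟨ +-monoˡ-≤ (2 * k) (subst (λ n → wt m ≤ 2 * n) len≡1 (wt≤2*len m)) ⟩
      2 + 2 * k           ≡⟨ 2[1+k]≡2+2k k ⟨
      2 * suc k           ≤⟨ *-monoʳ-≤ 2 k<D ⟩
      2 * Dof a           <⟨ 2*D<a 3≤a ⟩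
      a                   ∎
    2ℓ≤1+a : 2 * (len m + 2 * k) ≤ suc a
    2ℓ≤1+a = begin
      2 * (len m + 2 * k) ≡⟨ cong (λ n → 2 * (n + 2 * k)) len≡1 ⟩
      2 * (1 + 2 * k)     ≡⟨ *-distribˡ-+ 2 1 (2 * k) ⟩
      2 + 2 * (2 * k)     ≤⟨ +-monoʳ-≤ 2 (*-monoʳ-≤ 2 2k≤L) ⟩
      2 + 2 * L           ≡⟨⟩
      suc (suc (2 * L))   ≤⟨ s≤s (2*L<a 1≤a) ⟩
      suc a               ∎

  bounds : (2 * Dof a ≤ L + 2) × (2 * suc k ≤ L + 2) × (I ≤ L)
  bounds = 2*D≤L+2 a , 2[1+k]≤L+2 , subst (_≤ L) (sym I≡L∸2k) (m∸n≤m L (2 * k))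

  level≤L : ∀ {i} → i ≤ I → (2 * suc k ∸ 2) + i ≤ L
  level≤L {i} i≤I = subst (_≤ L) (sym (level≡ i)) (i≤I⇒i+2k≤L i≤I)

  Sdi⊆[0,𝓛[ : ∀ {i r} → i ≤ I → InSdi a (suc k) i r → (+ 0 ≤ℤ r) × (r <ℤ + 𝓛 a)
  Sdi⊆[0,𝓛[ i≤I s with Sdi⇒atLevel {a} {k} s
  ... | m , rm , refl , refl = +≤+ z≤n , +<+ (begin-strict
    atLevel a m k           ≤⟨ atLevel≤[len+2k]*[a+2] a m k ⟩
    (len m + 2 * k) * (a + 2) ≤⟨ *-monoˡ-≤ (a + 2) (i≤I⇒i+2k≤L i≤I) ⟩
    L * (a + 2)             ≡⟨ *-comm L (a + 2) ⟩
    (a + 2) * L             <⟨ [a+2]*L<𝓛 1≤a ⟩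
    𝓛 a                     ∎)
    where open ≤-Reasoning

  Sdi≡Sd∩Sℓ : ∀ {i} r → i ≤ I →
              InSdi a (suc k) i (+ r) ⟺ (InSd a (suc k) r × InSℓ a ((2 * suc k ∸ 2) + i) r)
  Sdi≡Sd∩Sℓ {i} r i≤I = fwd , bwd
    where
    fwd : InSdi a (suc k) i (+ r) → InSd a (suc k) r × InSℓ a ((2 * suc k ∸ 2) + i) r
    fwd s with Sdi⇒atLevel {a} {k} s
    ... | m , rm , refl , r≡ with ZP.+-injective r≡
    ... | refl = subst (λ ℓ → InSd a (suc k) r × InSℓ a ℓ r) (sym (level≡ (len m)))
                       (atLevel-Sd×Sℓ rm (≤L⇒Bounded m (i≤I⇒i+2k≤L i≤I)))
    bwd : InSd a (suc k) r × InSℓ a ((2 * suc k ∸ 2) + i) r → InSdi a (suc k) i (+ r)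
    bwd (sd , (α , p) , len≡) with Sd⇒atLevel sd α p 1≤a (subst (_≤ L) (sym (len≡ α p)) (level≤L i≤I))
    ... | m , rm , len≡′ , refl = subst (λ j → InSdi a (suc k) j (+ r)) len-m≡i (atLevel⇒Sdi {a} {k} rm)
      where
      len-m≡i : len m ≡ i
      len-m≡i = +-cancelʳ-≡ (2 * k) (len m) i (trans (sym len≡′) (trans (len≡ α p) (level≡ i)))

  Sd∩⋃Sℓ≡⋃Sdi : ∀ r → (InSd a (suc k) r × InUnionSℓ a r) ⟺ Σ ℕ (λ i → i ≤ I × InSdi a (suc k) i (+ r))
  Sd∩⋃Sℓ≡⋃Sdi r = fwd , bwd
    where
    fwd : InSd a (suc k) r × InUnionSℓ a r → Σ ℕ (λ i → i ≤ I × InSdi a (suc k) i (+ r))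
    fwd (sd , l , l≤L , (α , p) , len≡) with subst (_≤ L) (sym (len≡ α p)) l≤L
    ... | len≤L with Sd⇒atLevel sd α p 1≤a len≤L
    ... | m , rm , len≡′ , refl = len m , i+2k≤L⇒i≤I (subst (_≤ L) len≡′ len≤L) , atLevel⇒Sdi {a} {k} rm
    bwd : Σ ℕ (λ i → i ≤ I × InSdi a (suc k) i (+ r)) → InSd a (suc k) r × InUnionSℓ a r
    bwd (i , i≤I , s) = proj₁ sd×sℓ , (2 * suc k ∸ 2) + i , level≤L i≤I , proj₂ sd×sℓ
      where sd×sℓ = proj₁ (Sdi≡Sd∩Sℓ r i≤I) s

  Sd0≡rd : ∀ r → InSdi a (suc k) 0 r ⟺ r ≡ + rof a (suc k)
  Sd0≡rd r = (λ { (_ , refl , r≡) → trans r≡ rd-form }) , λ r≡ → + 0 , refl , trans r≡ (sym rd-form)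
    where
    rd-form : + ((a + 1) * ((2 * suc k ∸ 2) + 0)) +ℤ + 0 ≡ + rof a (suc k)
    rd-form = trans (ZP.+-identityʳ _) (cong (λ n → + ((a + 1) * n)) (+-identityʳ _))

  rd∈Sd∩⋃Sℓ : InSd a (suc k) (rof a (suc k)) × InUnionSℓ a (rof a (suc k))
  rd∈Sd∩⋃Sℓ = proj₂ (Sd∩⋃Sℓ≡⋃Sdi (rof a (suc k))) (0 , z≤n , proj₂ (Sd0≡rd _) refl)

  rd-minimal : ∀ r → InSd a (suc k) r → InUnionSℓ a r → rof a (suc k) ≤ r
  rd-minimal r sd u with proj₁ (Sd∩⋃Sℓ≡⋃Sdi r) (sd , u)
  ... | _ , _ , s with Sdi⇒atLevel {a} {k} s
  ... | m , _ , _ , r≡ = subst₂ _≤_ (sym rd≡) (sym (ZP.+-injective r≡)) (m≤n+m _ (ev a m))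

  module _ {c ℓ : Level} (K : Field c ℓ) where
    open Poly K
    open Shift K using (span-cong)

    W-rd : SameSet (InW a (rof a (suc k))) (InSpan (RdMon (suc k)))
    W-rd = span-cong λ α → fwd α , bwd α
      where
      bd0 : Bounded a (0 , 0 , 0) k
      bd0 = ≤L⇒Bounded (0 , 0 , 0) 2k≤L
      fwd : ∀ α → InF a (rof a (suc k)) α → RdMon (suc k) α
      fwd α p with factorization-shape {a} {k = k} (xᵏyᵖ z≤n 0) bd0 α (trans p rd≡)
      ... | t , t≤k , refl = k ∸ t , m∸n≤m k t , cong (λ s → (s , 2 * (k ∸ t) , s)) (sym (m∸[m∸n]≡n t≤k))
      bwd : ∀ α → RdMon (suc k) α → InF a (rof a (suc k)) α
      bwd _ (j , j≤k , refl) =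
        trans (ev-balanced a (k ∸ j) j) (trans (cong (λ l → (a + 1) * (2 * l)) (m∸n+n≡m j≤k)) (sym rd≡))

    W-Sdi : ∀ {i c r} (γ : Γ i c) → (∀ {m} → len m ≡ i → Bounded a m k) → InSdi a (suc k) i (+ r) →
            cr a r ≡ c → SameSet (InW a r) (InMulW (monomialOf γ) (InW a (rof a (suc k))))
    W-Sdi γ len≡i⇒Bounded s cr≡ with Sdi⇒atLevel {a} {k} s
    ... | m , rm , len≡ , r≡ with ZP.+-injective r≡
    ... | refl = subst (λ μ → SameSet (InW a _) (InMulW μ (InW a (rof a (suc k))))) m≡m* W-r
      where
      bd = len≡i⇒Bounded len≡
      W-r : SameSet (InW a (atLevel a m k)) (InMulW m (InW a (rof a (suc k))))
      W-r rewrite rd≡ = W-atLevel K rm bd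
      spec = proj₂ (reduced-of-Γ γ)
      m≡m* : m ≡ monomialOf γ
      m≡m* = cOf-injective rm (proj₁ spec) (trans len≡ (sym (proj₁ (proj₂ spec))))
               (trans (sym (cr-atLevel rm bd)) (trans cr≡ (sym (proj₂ (proj₂ spec)))))

    W-Sd1 : ∀ r → InSdi a (suc k) 1 (+ r) →
        (cr a r ≡ - (+ 1) → SameSet (InW a r) (InMulW (1 , 0 , 0) (InW a (rof a (suc k)))))
      × (cr a r ≡ + 0 → SameSet (InW a r) (InMulW (0 , 1 , 0) (InW a (rof a (suc k)))))
      × (cr a r ≡ + 1 → SameSet (InW a r) (InMulW (0 , 0 , 1) (InW a (rof a (suc k)))))
    W-Sd1 r s = W-Sdi (inj₁ refl) len≡1⇒Bounded s ,
                W-Sdi (inj₂ (inj₁ refl)) len≡1⇒Bounded s ,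
                W-Sdi (inj₂ (inj₂ refl)) len≡1⇒Bounded s

    W-Sd≥2 : ∀ i r → 2 ≤ i → i ≤ I → InSdi a (suc k) i (+ r) →
        (cr a r ≡ - (+ i) → SameSet (InW a r) (InMulW (i , 0 , 0) (InW a (rof a (suc k)))))
      × (cr a r ≡ - (+ i) +ℤ + 1 → SameSet (InW a r) (InMulW (i ∸ 1 , 1 , 0) (InW a (rof a (suc k)))))
      × (cr a r ≡ + (i ∸ 1) → SameSet (InW a r) (InMulW (0 , 1 , i ∸ 1) (InW a (rof a (suc k)))))
      × (cr a r ≡ + i → SameSet (InW a r) (InMulW (0 , 0 , i) (InW a (rof a (suc k)))))
    W-Sd≥2 1 _ (s≤s ())
    W-Sd≥2 i@(suc (suc _)) r _ i≤I s =
      W-Sdi (inj₁ refl) len≡i⇒Bounded s , W-Sdi (inj₂ (inj₁ refl)) len≡i⇒Bounded s ,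
      W-Sdi (inj₂ (inj₂ (inj₁ refl))) len≡i⇒Bounded s , W-Sdi (inj₂ (inj₂ (inj₂ refl))) len≡i⇒Bounded s
      where
      len≡i⇒Bounded : ∀ {m} → len m ≡ i → Bounded a m k
      len≡i⇒Bounded {m} len≡ = ≤L⇒Bounded m (subst (λ n → n + 2 * k ≤ L) (sym len≡) (i≤I⇒i+2k≤L i≤I))

corollary3p5 : ∀ {c ℓ : Level} (K : Field c ℓ) (a d : ℕ) .{{_ : NonZero a}}
  → 3 ≤ a → 1 ≤ d → d ≤ Dof a
  → let open Poly K in
    -- (1)
    ((2 * Dof a ≤ Lof a + 2) × (2 * d ≤ Lof a + 2) × (Iof a d ≤ Lof a))
    -- (2)
  × (∀ i → i ≤ Iof a d →
        ((2 * d ∸ 2) + i ≤ Lof a)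
      × (∀ (r : ℤ) → InSdi a d i r → (+ 0 ≤ℤ r) × (r <ℤ + 𝓛 a))
      × (∀ (r : ℕ) → InSdi a d i (+ r) ⟺ (InSd a d r × InSℓ a ((2 * d ∸ 2) + i) r)))
    -- (3)
  × (∀ (r : ℕ) → (InSd a d r × InUnionSℓ a r)
                  ⟺ Σ ℕ (λ i → i ≤ Iof a d × InSdi a d i (+ r)))
    -- (4)
  × (∀ (r : ℕ) → (InS a r × r ≤ (a + 2) * Lof a)
                  ⟺ (Σ ℕ (λ d′ → 1 ≤ d′ × d′ ≤ Dof a × InSd a d′ r) × InUnionSℓ a r))
    -- (5)
  × ((∀ (r : ℤ) → InSdi a d 0 r ⟺ r ≡ + rof a d)
    × (InSd a d (rof a d) × InUnionSℓ a (rof a d))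
    × (∀ (r : ℕ) → InSd a d r → InUnionSℓ a r → rof a d ≤ r)
    × SameSet (InW a (rof a d)) (InSpan (RdMon d)))
    -- (6)
  × (∀ (r : ℕ) → InSdi a d 1 (+ r) →
        (cr a r ≡ - (+ 1) → SameSet (InW a r) (InMulW (1 , 0 , 0) (InW a (rof a d))))
      × (cr a r ≡ + 0 → SameSet (InW a r) (InMulW (0 , 1 , 0) (InW a (rof a d))))
      × (cr a r ≡ + 1 → SameSet (InW a r) (InMulW (0 , 0 , 1) (InW a (rof a d)))))
    -- (7)
  × (∀ (i r : ℕ) → 2 ≤ i → i ≤ Iof a d → InSdi a d i (+ r) →
        (cr a r ≡ - (+ i) → SameSet (InW a r) (InMulW (i , 0 , 0) (InW a (rof a d))))
      × (cr a r ≡ - (+ i) +ℤ + 1 →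
           SameSet (InW a r) (InMulW (i ∸ 1 , 1 , 0) (InW a (rof a d))))
      × (cr a r ≡ + (i ∸ 1) →
           SameSet (InW a r) (InMulW (0 , 1 , i ∸ 1) (InW a (rof a d))))
      × (cr a r ≡ + i → SameSet (InW a r) (InMulW (0 , 0 , i) (InW a (rof a d)))))
corollary3p5 K a zero _ () _
corollary3p5 K a (suc k) 3≤a _ k<D =
  bounds ,
  (λ i i≤I → level≤L i≤I , (λ r → Sdi⊆[0,𝓛[ i≤I) , λ r → Sdi≡Sd∩Sℓ r i≤I) ,
  Sd∩⋃Sℓ≡⋃Sdi ,
  S∩[0,[a+2]L] 1≤a ,
  (Sd0≡rd , rd∈Sd∩⋃Sℓ , rd-minimal , W-rd K) ,
  W-Sd1 K ,
  W-Sd≥2 K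
  where open Corollary a k 3≤a k<D
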